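{- Let $i\ge0$ be an integer, $G$ an $\alpha_i$-metric graph and $k$ a positive integer. Then every vertex $v$ of $G$ with $e(v)\le\operatorname{rad}(G)+k$ satisfies $d(v,C(G))\le k+i$.
   Context: All graphs are finite, connected, unweighted, undirected, simple; $d(u,v)$ is the shortest-path distance, $d(v,S)=\min_{s\in S}d(v,s)$. $I(u,v)=\{x: d(u,x)+d(x,v)=d(u,v)\}$. A graph is $\alpha_i$-metric if for all vertices $u,w,v,x$: whenever $v\in I(u,w)$, $w\in I(v,x)$ and $vw$ is an edge, then $d(u,x)\ge d(u,v)+d(v,x)-i$. $e(v)=\max_u d(u,v)$; $\operatorname{rad}(G)=\min_v e(v)$; $C(G)=\{v:e(v)=\operatorname{rad}(G)\}$. -}

module Defs where

open import Data.Nat using (ℕ; zero; suc; _+_; _≤_; _⊔_; _⊓_)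
open import Data.Fin using (Fin)
open import Data.List using (foldr)
open import Data.Fin.Base using () renaming (zero to fzero)
open import Data.List using (allFin)
open import Data.Product using (_×_; Σ)
open import Relation.Binary.PropositionalEquality using (_≡_)
open import Relation.Nullary using (¬_)

record Graph (n : ℕ) : Set₁ where
  field
    Adj     : Fin n → Fin n → Set
    sym     : ∀ {u v} → Adj u v → Adj v u
    irrefl  : ∀ {u} → ¬ Adj u u
open Graph public

data Walk {n : ℕ} (G : Graph n) : Fin n → Fin n → ℕ → Set where
  here : ∀ {u} → Walk G u u 0
  step : ∀ {u v w ℓ} → Adj G u v → Walk G v w ℓ → Walk G u w (suc ℓ)

-- d is the shortest-path distance of G: for all u v there is a walk of
-- length d u v, and every walk from u to v has length at least d u v.
-- (Existence of such walks for all pairs also encodes connectedness.)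
record IsDistance {n : ℕ} (G : Graph n) (d : Fin n → Fin n → ℕ) : Set where
  field
    realised : ∀ u v → Walk G u v (d u v)
    minimal  : ∀ {u v ℓ} → Walk G u v ℓ → d u v ≤ ℓ
open IsDistance public

_∈I[_,_]by_ : {n : ℕ} → Fin n → Fin n → Fin n → (Fin n → Fin n → ℕ) → Set
x ∈I[ u , v ]by d = d u x + d x v ≡ d u v

AlphaMetric : {n : ℕ} → (G : Graph n) → (d : Fin n → Fin n → ℕ) → ℕ → Set
AlphaMetric G d i =
  ∀ u w v x → v ∈I[ u , w ]by d → w ∈I[ v , x ]by d → Adj G v w →
  d u v + d v x ≤ d u x + i

ecc : {n : ℕ} → (Fin n → Fin n → ℕ) → Fin n → ℕ
ecc {n} d v = foldr (λ u m → d u v ⊔ m) 0 (allFin n)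

rad : {n : ℕ} → (Fin (suc n) → Fin (suc n) → ℕ) → ℕ
rad {n} d = foldr (λ v m → ecc d v ⊓ m) (ecc d fzero) (allFin (suc n))

InCenter : {n : ℕ} → (Fin (suc n) → Fin (suc n) → ℕ) → Fin (suc n) → Set
InCenter d c = ecc d c ≡ rad d

-- Walk from a central vertex towards v along a shortest path and stop at the last central
-- vertex c before leaving the center (or at v itself).  The next vertex w is not central, so
-- some u has d(u,w) > rad ≥ d(u,c); hence c ∈ I(u,w), d(u,c) = rad, and w ∈ I(c,v).  The
-- α_i-metric inequality then gives rad + d(c,v) ≤ d(u,v) + i ≤ e(v) + i ≤ rad + k + i.
module Submission where

open import Defs
open import Data.Nat using (ℕ; suc; zero; _+_; _≤_; _<_; _⊔_; _⊓_; z≤n; s≤s; _≟_)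
open import Data.Nat.Properties
open import Data.Fin using (Fin)
open import Data.Fin.Base using () renaming (zero to fzero)
open import Data.Product using (Σ; _×_; _,_)
open import Data.Sum using (inj₁; inj₂)
open import Data.List using (List; []; _∷_; foldr; allFin)
open import Data.List.Membership.Propositional using (_∈_)
open import Data.List.Membership.Propositional.Properties using (∈-allFin)
open import Data.List.Relation.Unary.Any using (here; there)
open import Relation.Binary.PropositionalEquality
  using (_≡_; refl; trans; cong; subst; module ≡-Reasoning)
  renaming (sym to ≡-sym)
open import Relation.Nullary using (yes; no; ¬_)
open import Data.Empty using (⊥-elim)

module _ {A : Set} (f : A → ℕ) where

  foldr-⊔-upperBound : ∀ (xs : List A) {x} → x ∈ xs → f x ≤ foldr (λ y m → f y ⊔ m) 0 xs
  foldr-⊔-upperBound (y ∷ ys) (here refl) = m≤m⊔n (f y) _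
  foldr-⊔-upperBound (y ∷ ys) (there x∈ys) =
    ≤-trans (foldr-⊔-upperBound ys x∈ys) (m≤n⊔m (f y) _)

  foldr-⊔-exceeds : ∀ (xs : List A) {r} → r < foldr (λ y m → f y ⊔ m) 0 xs → Σ A (λ x → r < f x)
  foldr-⊔-exceeds (y ∷ ys) r< with ⊔-sel (f y) (foldr (λ y m → f y ⊔ m) 0 ys)
  ... | inj₁ eq = y , subst (_ <_) eq r<
  ... | inj₂ eq = foldr-⊔-exceeds ys (subst (_ <_) eq r<)

  foldr-⊓-lowerBound : ∀ z (xs : List A) {x} → x ∈ xs → foldr (λ y m → f y ⊓ m) z xs ≤ f x
  foldr-⊓-lowerBound z (y ∷ ys) (here refl) = m⊓n≤m (f y) _
  foldr-⊓-lowerBound z (y ∷ ys) (there x∈ys) =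
    ≤-trans (m⊓n≤n (f y) _) (foldr-⊓-lowerBound z ys x∈ys)

  foldr-⊓-attained : ∀ a (xs : List A) → Σ A (λ x → f x ≡ foldr (λ y m → f y ⊓ m) (f a) xs)
  foldr-⊓-attained a [] = a , refl
  foldr-⊓-attained a (y ∷ ys) with ⊓-sel (f y) (foldr (λ y m → f y ⊓ m) (f a) ys)
  ... | inj₁ eq = y , ≡-sym eq
  ... | inj₂ eq with foldr-⊓-attained a ys
  ...   | x , fx≡ = x , trans fx≡ (≡-sym eq)

module _ {n : ℕ} (d : Fin n → Fin n → ℕ) where

  d≤ecc : ∀ u v → d u v ≤ ecc d v
  d≤ecc u v = foldr-⊔-upperBound (λ u → d u v) (allFin n) (∈-allFin u)

  ecc-exceeds : ∀ {r} v → r < ecc d v → Σ (Fin n) (λ u → r < d u v)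
  ecc-exceeds v = foldr-⊔-exceeds (λ u → d u v) (allFin n)

module _ {n : ℕ} (d : Fin (suc n) → Fin (suc n) → ℕ) where

  rad≤ecc : ∀ v → rad d ≤ ecc d v
  rad≤ecc v = foldr-⊓-lowerBound (ecc d) (ecc d fzero) (allFin (suc n)) (∈-allFin v)

  center-nonempty : Σ (Fin (suc n)) (InCenter d)
  center-nonempty = foldr-⊓-attained (ecc d) fzero (allFin (suc n))

module _ {n : ℕ} (G : Graph n) where

  _++ʷ_ : ∀ {a b c l m} → Walk G a b l → Walk G b c m → Walk G a c (l + m)
  here     ++ʷ q = q
  step e p ++ʷ q = step e (p ++ʷ q)

  reverseOnto : ∀ {a b c l m} → Walk G a b l → Walk G a c m → Walk G b c (l + m)
  reverseOnto here acc = acc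
  reverseOnto {l = suc l} {m} (step e p) acc =
    subst (Walk G _ _) (+-suc l m) (reverseOnto p (step (Graph.sym G e) acc))

  reverseʷ : ∀ {a b l} → Walk G a b l → Walk G b a l
  reverseʷ {l = l} p = subst (Walk G _ _) (+-identityʳ l) (reverseOnto p here)

  walk-length0 : ∀ {a b} → Walk G a b 0 → a ≡ b
  walk-length0 here = refl

module _ {n : ℕ} {G : Graph n} {d : Fin n → Fin n → ℕ} (D : IsDistance G d) where

  d-sym : ∀ u v → d u v ≡ d v u
  d-sym u v = ≤-antisym (minimal D (reverseʷ G (realised D v u)))
                        (minimal D (reverseʷ G (realised D u v)))

  d-triangle : ∀ u x v → d u v ≤ d u x + d x v
  d-triangle u x v = minimal D (_++ʷ_ G (realised D u x) (realised D x v))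

  d-adjacent : ∀ {u v} → Adj G u v → d u v ≡ 1
  d-adjacent {u} {v} e with d u v | realised D u v | minimal D (step e (here {G = G}))
  ... | zero        | w | _      = ⊥-elim (irrefl G (subst (Adj G u) (≡-sym (walk-length0 G w)) e))
  ... | suc zero    | _ | _      = refl
  ... | suc (suc _) | _ | s≤s ()

  geodesic-step : ∀ {u v q} → d u v ≡ suc q →
                  Σ (Fin n) (λ w → Adj G u w × w ∈I[ u , v ]by d × d w v ≡ q)
  geodesic-step {u} {v} {q} eq with subst (Walk G u v) eq (realised D u v)
  ... | step {v = w} e wv = w , e , between , dwv
    where
    dwv : d w v ≡ q
    dwv = ≤-antisym (minimal D wv) (+-cancelˡ-≤ 1 _ _ (begin
      suc q           ≡⟨ ≡-sym eq ⟩
      d u v           ≤⟨ d-triangle u w v ⟩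
      d u w + d w v   ≡⟨ cong (_+ d w v) (d-adjacent e) ⟩
      1 + d w v       ∎))
      where open ≤-Reasoning
    between : d u w + d w v ≡ d u v
    between rewrite d-adjacent e | dwv | eq = refl

module _ {n : ℕ} {G : Graph (suc n)} {d : Fin (suc n) → Fin (suc n) → ℕ}
         (D : IsDistance G d) {i : ℕ} (α : AlphaMetric G d i) where

  center-exit-bound : ∀ {c w v} → InCenter d c → Adj G c w → ¬ InCenter d w →
                      w ∈I[ c , v ]by d → rad d + d c v ≤ ecc d v + i
  center-exit-bound {c} {w} {v} c∈C e w∉C w∈I
    with ecc-exceeds d w (≤∧≢⇒< (rad≤ecc d w) (λ eq → w∉C (≡-sym eq)))
  ... | u , rad<duw = begin
    rad d + d c v   ≤⟨ +-monoˡ-≤ (d c v) rad≤duc ⟩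
    d u c + d c v   ≤⟨ α u w c v c∈I w∈I e ⟩
    d u v + i       ≤⟨ +-monoˡ-≤ i (d≤ecc d u v) ⟩
    ecc d v + i     ∎
    where
    open ≤-Reasoning
    duw≤duc+1 : d u w ≤ d u c + 1
    duw≤duc+1 = subst (λ t → d u w ≤ d u c + t) (d-adjacent D e) (d-triangle D u c w)
    rad+1≤duw : rad d + 1 ≤ d u w
    rad+1≤duw = subst (_≤ d u w) (+-comm 1 (rad d)) rad<duw
    rad≤duc : rad d ≤ d u c
    rad≤duc = +-cancelʳ-≤ 1 _ _ (≤-trans rad+1≤duw duw≤duc+1)
    duc≤rad : d u c ≤ rad d
    duc≤rad = subst (d u c ≤_) c∈C (d≤ecc d u c)
    c∈I : c ∈I[ u , w ]by d
    c∈I = trans (cong (d u c +_) (d-adjacent D e))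
                (≤-antisym (≤-trans (+-monoˡ-≤ 1 duc≤rad) rad+1≤duw) duw≤duc+1)

  center-near-vertex : ∀ v → Σ (Fin (suc n)) (λ c → InCenter d c × rad d + d c v ≤ ecc d v + i)
  center-near-vertex v with center-nonempty d
  ... | c₀ , c₀∈C = descend (d c₀ v) c₀ c₀∈C refl
    where
    descend : ∀ p c → InCenter d c → d c v ≡ p →
              Σ (Fin (suc n)) (λ c → InCenter d c × rad d + d c v ≤ ecc d v + i)
    descend zero c c∈C dcv≡0 = c , c∈C ,
      subst (λ t → rad d + t ≤ ecc d v + i) (≡-sym dcv≡0) (+-mono-≤ (rad≤ecc d v) z≤n)
    descend (suc q) c c∈C dcv≡ with geodesic-step D dcv≡
    ... | w , e , w∈I , dwv≡ with ecc d w ≟ rad d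
    ...   | yes w∈C = descend q w w∈C dwv≡
    ...   | no  w∉C = c , c∈C , center-exit-bound c∈C e w∉C w∈I

lemma8 : (i : ℕ) {n : ℕ} (G : Graph (suc n)) (d : Fin (suc n) → Fin (suc n) → ℕ) →
    IsDistance G d → AlphaMetric G d i →
    (k : ℕ) → 1 ≤ k →
    (v : Fin (suc n)) → ecc d v ≤ rad d + k →
    Σ (Fin (suc n)) (λ c → InCenter d c × d v c ≤ k + i)
lemma8 i G d D α k _ v ev with center-near-vertex D α v
... | c , c∈C , bound = c , c∈C , +-cancelˡ-≤ (rad d) _ _ (begin
  rad d + d v c   ≡⟨ cong (rad d +_) (d-sym D v c) ⟩
  rad d + d c v   ≤⟨ bound ⟩
  ecc d v + i     ≤⟨ +-monoˡ-≤ i ev ⟩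
  rad d + k + i   ≡⟨ +-assoc (rad d) k i ⟩
  rad d + (k + i) ∎)
  where open ≤-Reasoning
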